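{- Let $G$ be a $B_1$-EPG graph that is diamond-free. Then in any $B_1$-EPG representation of $G$, every maximal clique $K$ of $G$ that is a claw-clique is represented on a claw of the grid whose three edges are covered only by paths of vertices of $K$.
   Context: All graphs are finite and simple. An EPG representation of $G$ assigns to each vertex $v$ a path $P_v$ in the rectangular grid such that two distinct vertices are adjacent iff their paths share at least one grid edge; it is a $B_1$-EPG representation if every path has at most one bend, and $G$ is $B_1$-EPG if it has one. A claw of the grid is a set of three grid edges incident to a common grid point (its center). In a $B_1$-EPG representation, a clique $K$ is an edge-clique if all paths of vertices of $K$ share a common grid edge; otherwise there is a unique claw of the grid such that each path of a vertex of $K$ contains exactly two of the three edges of the claw, and $K$ is then called a claw-clique represented on that claw. The diamond is the graph on vertices $a,b,c,d$ with edges $ab,ac,bc,bd,cd$; diamond-free means no induced diamond. -}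

module Defs where

open import Data.Integer using (ℤ; +_) renaming (_+_ to _+ℤ_)
import Data.Integer.Properties as ℤP
open import Data.Nat using (ℕ; _≤_; _+_)
open import Data.Bool using (Bool; true; false; not; _∨_; if_then_else_)
open import Data.Fin using (Fin)
open import Data.Fin.Subset using (Subset; _∈_; _∉_; _⊆_)
open import Data.List using (List; []; _∷_; length)
open import Data.List.Relation.Unary.All using (All)
open import Data.List.Relation.Unary.Any using (Any)
open import Data.List.Relation.Unary.Unique.Propositional using (Unique)
open import Data.Product using (Σ; ∃; _×_; _,_; proj₁; proj₂)
open import Data.Sum using (_⊎_)
open import Relation.Nullary using (¬_)
open import Relation.Nullary.Decidable using (⌊_⌋)
open import Relation.Binary.PropositionalEquality using (_≡_; _≢_)

Point : Set
Point = ℤ × ℤ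

data GEdge : Set where
  hor : ℤ → ℤ → GEdge
  ver : ℤ → ℤ → GEdge

ends : GEdge → Point × Point
ends (hor x y) = (x , y) , (x +ℤ + 1 , y)
ends (ver x y) = (x , y) , (x , y +ℤ + 1)

Joins : GEdge → Point → Point → Set
Joins e p q = (p ≡ proj₁ (ends e) × q ≡ proj₂ (ends e))
            ⊎ (p ≡ proj₂ (ends e) × q ≡ proj₁ (ends e))

Incident : GEdge → Point → Set
Incident e p = p ≡ proj₁ (ends e) ⊎ p ≡ proj₂ (ends e)

pairs : {A : Set} → List A → List (A × A)
pairs (x ∷ y ∷ xs) = (x , y) ∷ pairs (y ∷ xs)
pairs _            = []

-- a path through p, q, r (consecutive) bends at q iff p and r differ
-- in both coordinates
isBend : Point → Point → Bool
isBend (x₁ , y₁) (x₂ , y₂) = not (⌊ x₁ ℤP.≟ x₂ ⌋ ∨ ⌊ y₁ ℤP.≟ y₂ ⌋)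

bends : List Point → ℕ
bends (p ∷ q ∷ r ∷ xs) = (if isBend p r then 1 else 0) + bends (q ∷ r ∷ xs)
bends _                = 0

record GridPath : Set where
  field
    pts        : List Point
    nontrivial : 2 ≤ length pts
    steps      : All (λ pq → Σ GEdge λ e → Joins e (proj₁ pq) (proj₂ pq)) (pairs pts)
    simple     : Unique pts
open GridPath public

_∈E_ : GEdge → GridPath → Set
e ∈E P = Any (λ pq → Joins e (proj₁ pq) (proj₂ pq)) (pairs (pts P))

record Graph : Set₁ where
  field
    n      : ℕ
    Adj    : Fin n → Fin n → Set
    sym    : ∀ {u v} → Adj u v → Adj v u
    irrefl : ∀ {u} → ¬ Adj u u
open Graph public

DiamondFree : Graph → Set
DiamondFree G = ∀ a b c d → a ≢ b → a ≢ c → a ≢ d → b ≢ c → b ≢ d → c ≢ d →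
  ¬ (Adj G a b × Adj G a c × Adj G b c × Adj G b d × Adj G c d × ¬ Adj G a d)

IsClique : (G : Graph) → Subset (n G) → Set
IsClique G K = ∀ u v → u ∈ K → v ∈ K → u ≢ v → Adj G u v

IsMaximalClique : (G : Graph) → Subset (n G) → Set
IsMaximalClique G K = IsClique G K × (∀ K′ → IsClique G K′ → K ⊆ K′ → K′ ⊆ K)

record EPGRep (G : Graph) : Set where
  field
    path   : Fin (n G) → GridPath
    adj-iff : ∀ u v → u ≢ v →
      (Adj G u v → ∃ λ e → e ∈E path u × e ∈E path v) ×
      ((∃ λ e → e ∈E path u × e ∈E path v) → Adj G u v)
open EPGRep public

IsB1 : {G : Graph} → EPGRep G → Set
IsB1 {G} R = ∀ v → bends (pts (path R v)) ≤ 1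

record Claw : Set where
  field
    center : Point
    e₁ e₂ e₃ : GEdge
    inc₁ : Incident e₁ center
    inc₂ : Incident e₂ center
    inc₃ : Incident e₃ center
    d₁₂  : e₁ ≢ e₂
    d₁₃  : e₁ ≢ e₃
    d₂₃  : e₂ ≢ e₃
open Claw public

_∈C_ : GEdge → Claw → Set
e ∈C C = e ≡ e₁ C ⊎ e ≡ e₂ C ⊎ e ≡ e₃ C

ContainsExactlyTwo : GridPath → Claw → Set
ContainsExactlyTwo P C =
    (e₁ C ∈E P × e₂ C ∈E P × ¬ e₃ C ∈E P)
  ⊎ (e₁ C ∈E P × ¬ e₂ C ∈E P × e₃ C ∈E P)
  ⊎ (¬ e₁ C ∈E P × e₂ C ∈E P × e₃ C ∈E P)

IsEdgeClique : {G : Graph} → EPGRep G → Subset (n G) → Set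
IsEdgeClique R K = ∃ λ e → ∀ v → v ∈ K → e ∈E path R v

IsClawClique : {G : Graph} → EPGRep G → Subset (n G) → Set
IsClawClique {G} R K = IsClique G K × ¬ IsEdgeClique R K

RepresentedOn : {G : Graph} → EPGRep G → Subset (n G) → Claw → Set
RepresentedOn R K C = ∀ v → v ∈ K → ContainsExactlyTwo (path R v) C

-- The edge set of a path with at most one bend is an L: on each of a horizontal and a vertical
-- grid line an interval of edges, the line of each arm passing through an end of the other.
-- All paths of the claw-clique K have an arm on one common line ℓ, say horizontal: otherwise
-- two members avoiding the horizontal and the vertical line of a third one could share no edge.
-- Let a be the member whose arm on ℓ ends first, at m.  As K is no edge-clique, some member b
-- misses the last edge of a on ℓ, so b's arm on ℓ starts at m, and the edge shared by a and b
-- is vertical: both bend at (m, ℓ), towards the same side.  The claw at (m, ℓ) consists of the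
-- two edges of ℓ at m and the vertical edge on that side.  A member containing the vertical edge
-- bends at (m, ℓ) and so has exactly one of the horizontal ones; any other member meets a and b
-- on ℓ and so has both.  Each claw edge lies on two members of K, so a path outside K through it
-- would give a vertex adjacent to two members of the maximal clique K, closing a diamond.

module Submission where

open import Defs
open import Data.Bool as Bool using (Bool; true; false; not)
import Data.Bool.Properties as BoolP
open import Data.Empty using (⊥; ⊥-elim)
open import Data.Fin as Fin using (Fin)
import Data.Fin.Properties as FinP
open import Data.Fin.Subset using (Subset; _∈_; _∉_; _∪_; ⁅_⁆)
open import Data.Fin.Subset.Properties using (_∈?_; x∈p∪q⁻; x∈p∪q⁺; p⊆p∪q; x∈⁅x⁆; x∈⁅y⁆⇒x≡y)
open import Data.Integer as ℤ using (ℤ; _≤_; _<_; 0ℤ; 1ℤ; pred) renaming (_+_ to _+ℤ_)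
import Data.Integer.Properties as ℤP
open import Data.List using (List; []; _∷_; length; filter; allFin)
open import Data.List.Extrema ℤP.≤-totalOrder using (argmin; argmin-all; f[argmin]≤f[xs])
open import Data.List.Membership.Propositional.Properties using (∈-filter⁺; ∈-allFin)
open import Data.List.Relation.Unary.All as All using (All; []; _∷_)
open import Data.List.Relation.Unary.All.Properties using (all-filter)
open import Data.List.Relation.Unary.Any using (Any; here; there)
open import Data.List.Relation.Unary.Unique.Propositional using (Unique)
open import Data.List.Relation.Unary.AllPairs using (_∷_)
open import Data.Nat as ℕ using (s≤s)
import Data.Nat.Properties as ℕP
open import Data.Product using (Σ; ∃; _×_; _,_; proj₁; proj₂)
open import Data.Sum using (_⊎_; inj₁; inj₂; [_,_]; assocˡ; assocʳ)
open import Data.Sum.Function.Propositional using (_⊎-⇔_)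
open import Function using (_⇔_; mk⇔; Equivalence; _∘_; id; const)
open import Function.Properties.Equivalence using () renaming (refl to ⇔-refl; trans to ⇔-trans; sym to ⇔-sym)
open import Relation.Nullary using (¬_; Dec; yes; no; ¬?)
open import Relation.Nullary.Decidable using (⌊_⌋; _×-dec_; decidable-stable)
open import Relation.Binary.PropositionalEquality as ≡ using (_≡_; _≢_; refl; trans; cong; subst)

open Equivalence using (to; from)

-- the successor as it appears in ends
_+1 : ℤ → ℤ
x +1 = x +ℤ 1ℤ

+1≡suc : ∀ x → x +1 ≡ ℤ.suc x
+1≡suc x = ℤP.+-comm x 1ℤ

pred[x+1]≡x : ∀ x → pred (x +1) ≡ x
pred[x+1]≡x x rewrite +1≡suc x = ℤP.pred-suc x

pred[x]+1≡x : ∀ x → pred x +1 ≡ x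
pred[x]+1≡x x = trans (+1≡suc (pred x)) (ℤP.suc-pred x)

x<x+1 : ∀ x → x < x +1
x<x+1 x rewrite +1≡suc x = ℤP.suc[i]≤j⇒i<j ℤP.≤-refl

<⇒+1≤ : ∀ {x y} → x < y → x +1 ≤ y
<⇒+1≤ {x} x<y rewrite +1≡suc x = ℤP.i<j⇒suc[i]≤j x<y

<+1⇒≤ : ∀ {x y} → x < y +1 → x ≤ y
<+1⇒≤ {x} {y} x<y+1 = subst (x ≤_) (pred[x+1]≡x y) (ℤP.i<j⇒i≤pred[j] x<y+1)

+1-injective : ∀ {x y} → x +1 ≡ y +1 → x ≡ y
+1-injective {x} {y} eq = trans (≡.sym (pred[x+1]≡x x)) (trans (cong pred eq) (pred[x+1]≡x y))

x≢x+1 : ∀ {x} → x ≢ x +1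
x≢x+1 {x} eq = ℤP.<-irrefl eq (x<x+1 x)

x+1+1≢x : ∀ {x} → x +1 +1 ≢ x
x+1+1≢x {x} eq = ℤP.<-irrefl (≡.sym eq) (ℤP.<-trans (x<x+1 x) (x<x+1 (x +1)))

≤⇒≡⊎+1≤ : ∀ {x y} → x ≤ y → y ≡ x ⊎ x +1 ≤ y
≤⇒≡⊎+1≤ {x} {y} x≤y with x ℤP.≟ y
... | yes x≡y = inj₁ (≡.sym x≡y)
... | no x≢y = inj₂ (<⇒+1≤ (ℤP.≤∧≢⇒< x≤y x≢y))

≤⇒≡⊎< : ∀ {x y} → x ≤ y → x ≡ y ⊎ x < y
≤⇒≡⊎< {x} {y} x≤y with x ℤP.≟ y
... | yes x≡y = inj₁ x≡y
... | no x≢y = inj₂ (ℤP.≤∧≢⇒< x≤y x≢y)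

-- Steps and bends in the grid

-- true: horizontal / increasing coordinate
Orientation Direction : Set
Orientation = Bool
Direction = Bool

along across : Orientation → Point → ℤ
along true p = proj₁ p
along false p = proj₂ p
across true p = proj₂ p
across false p = proj₁ p

Advance : Direction → ℤ → ℤ → Set
Advance true u v = v ≡ u +1
Advance false u v = u ≡ v +1

Step : Orientation → Direction → Point → Point → Set
Step o s p q = across o q ≡ across o p × Advance s (along o p) (along o q)

orientation : GEdge → Orientation
orientation (hor x y) = true
orientation (ver x y) = false

lineOf startOf : GEdge → ℤ
lineOf (hor x y) = y
lineOf (ver x y) = x
startOf (hor x y) = x
startOf (ver x y) = y

edge : Orientation → ℤ → ℤ → GEdge
edge true l c = hor c l
edge false l c = ver l c

edge-η : ∀ e → edge (orientation e) (lineOf e) (startOf e) ≡ e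
edge-η (hor x y) = refl
edge-η (ver x y) = refl

orientation-edge : ∀ o l c → orientation (edge o l c) ≡ o
orientation-edge true l c = refl
orientation-edge false l c = refl

lineOf-edge : ∀ o l c → lineOf (edge o l c) ≡ l
lineOf-edge true l c = refl
lineOf-edge false l c = refl

startOf-edge : ∀ o l c → startOf (edge o l c) ≡ c
startOf-edge true l c = refl
startOf-edge false l c = refl

≡edge : ∀ {e o l c} → orientation e ≡ o → lineOf e ≡ l → startOf e ≡ c → e ≡ edge o l c
≡edge {e} refl refl refl = ≡.sym (edge-η e)

stepEdge : Orientation → Direction → Point → Point → GEdge
stepEdge o true p q = edge o (across o p) (along o p)
stepEdge o false p q = edge o (across o q) (along o q)

Joins⇒Step : ∀ {e p q} → Joins e p q →
  Σ Direction λ s → Step (orientation e) s p q × e ≡ stepEdge (orientation e) s p q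
Joins⇒Step {hor x y} (inj₁ (refl , refl)) = true , (refl , refl) , refl
Joins⇒Step {hor x y} (inj₂ (refl , refl)) = false , (refl , refl) , refl
Joins⇒Step {ver x y} (inj₁ (refl , refl)) = true , (refl , refl) , refl
Joins⇒Step {ver x y} (inj₂ (refl , refl)) = false , (refl , refl) , refl

Step⇒Joins : ∀ o s p q → Step o s p q → Joins (stepEdge o s p q) p q
Step⇒Joins true true p q (refl , refl) = inj₁ (refl , refl)
Step⇒Joins true false p q (refl , refl) = inj₂ (refl , refl)
Step⇒Joins false true p q (refl , refl) = inj₁ (refl , refl)
Step⇒Joins false false p q (refl , refl) = inj₂ (refl , refl)

Advance-unique : ∀ s s′ {u v} → Advance s u v → Advance s′ u v → s ≡ s′
Advance-unique true true _ _ = refl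
Advance-unique false false _ _ = refl
Advance-unique true false refl v+1≡u = ⊥-elim (x+1+1≢x (≡.sym v+1≡u))
Advance-unique false true refl u+1≡v = ⊥-elim (x+1+1≢x (≡.sym u+1≡v))

Advance⇒≢ : ∀ s {u v} → Advance s u v → u ≢ v
Advance⇒≢ true refl = x≢x+1
Advance⇒≢ false refl = x≢x+1 ∘ ≡.sym

Step-unique : ∀ o s o′ s′ {p q} → Step o s p q → Step o′ s′ p q → o ≡ o′ × s ≡ s′
Step-unique true s true s′ (_ , a) (_ , a′) = refl , Advance-unique s s′ a a′
Step-unique false s false s′ (_ , a) (_ , a′) = refl , Advance-unique s s′ a a′
Step-unique true s false s′ (l , _) (_ , a′) = ⊥-elim (Advance⇒≢ s′ a′ (≡.sym l))
Step-unique false s true s′ (l , _) (_ , a′) = ⊥-elim (Advance⇒≢ s′ a′ (≡.sym l))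

Joins⇔≡stepEdge : ∀ o s p q → Step o s p q → ∀ e → Joins e p q ⇔ (e ≡ stepEdge o s p q)
Joins⇔≡stepEdge o s p q st e = mk⇔ joins⇒≡ (λ { refl → Step⇒Joins o s p q st })
  where
  joins⇒≡ : Joins e p q → e ≡ stepEdge o s p q
  joins⇒≡ j with Joins⇒Step {e} j
  ... | s′ , st′ , eq with Step-unique o s (orientation e) s′ st st′
  ... | refl , refl = eq

isBend-sameLine : ∀ o p r → across o p ≡ across o r → isBend p r ≡ false
isBend-sameLine true (p₁ , p₂) (r₁ , r₂) eq with p₂ ℤP.≟ r₂
... | no ne = ⊥-elim (ne eq)
... | yes _ with ⌊ p₁ ℤP.≟ r₁ ⌋
...   | true = refl
...   | false = refl
isBend-sameLine false (p₁ , p₂) (r₁ , r₂) eq with p₁ ℤP.≟ r₁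
... | no ne = ⊥-elim (ne eq)
... | yes _ = refl

isBend-true : ∀ p r → proj₁ p ≢ proj₁ r → proj₂ p ≢ proj₂ r → isBend p r ≡ true
isBend-true (p₁ , p₂) (r₁ , r₂) ne₁ ne₂ with p₁ ℤP.≟ r₁ | p₂ ℤP.≟ r₂
... | yes eq | _ = ⊥-elim (ne₁ eq)
... | no _ | yes eq = ⊥-elim (ne₂ eq)
... | no _ | no _ = refl

point-≡ : ∀ o {p r : Point} → along o p ≡ along o r → across o p ≡ across o r → p ≡ r
point-≡ true refl refl = refl
point-≡ false refl refl = refl

Advance-back : ∀ s s′ {u v w} → s ≢ s′ → Advance s u v → Advance s′ v w → u ≡ w
Advance-back true true s≢s′ _ _ = ⊥-elim (s≢s′ refl)
Advance-back false false s≢s′ _ _ = ⊥-elim (s≢s′ refl)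
Advance-back true false _ refl v≡w+1 = +1-injective v≡w+1
Advance-back false true _ refl refl = refl

turn⇒isBend : ∀ o s s′ {p q r} → Step o s p q → Step (not o) s′ q r → isBend p r ≡ true
turn⇒isBend true s s′ {p} {q} {r} (l , a) (l′ , a′) =
  isBend-true p r (λ e → Advance⇒≢ s a (trans e l′)) (λ e → Advance⇒≢ s′ a′ (trans l e))
turn⇒isBend false s s′ {p} {q} {r} (l , a) (l′ , a′) =
  isBend-true p r (λ e → Advance⇒≢ s′ a′ (trans l e)) (λ e → Advance⇒≢ s a (trans e l′))

straight⇒sameDirection : ∀ o s s′ {p q r} → Step o s p q → Step o s′ q r → p ≢ r → s ≡ s′
straight⇒sameDirection o s s′ (l , a) (l′ , a′) p≢r with s Bool.≟ s′
... | yes s≡s′ = s≡s′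
... | no s≢s′ = ⊥-elim (p≢r (point-≡ o (Advance-back s s′ s≢s′ a a′) (trans (≡.sym l) (≡.sym l′))))

unbent⇒straight : ∀ o s o′ s′ {p q r} → Step o s p q → Step o′ s′ q r → p ≢ r →
  isBend p r ≡ false → o ≡ o′ × s ≡ s′
unbent⇒straight true s true s′ st st′ p≢r _ = refl , straight⇒sameDirection true s s′ st st′ p≢r
unbent⇒straight false s false s′ st st′ p≢r _ = refl , straight⇒sameDirection false s s′ st st′ p≢r
unbent⇒straight true s false s′ st st′ _ unbent with () ← trans (≡.sym (turn⇒isBend true s s′ st st′)) unbent
unbent⇒straight false s true s′ st st′ _ unbent with () ← trans (≡.sym (turn⇒isBend false s s′ st st′)) unbent

bent⇒turn : ∀ o s o′ s′ {p q r} → Step o s p q → Step o′ s′ q r → isBend p r ≡ true → o′ ≡ not o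
bent⇒turn true s false s′ _ _ _ = refl
bent⇒turn false s true s′ _ _ _ = refl
bent⇒turn true s true s′ {p} {r = r} (l , _) (l′ , _) bent
  with () ← trans (≡.sym bent) (isBend-sameLine true p r (trans (≡.sym l) (≡.sym l′)))
bent⇒turn false s false s′ {p} {r = r} (l , _) (l′ , _) bent
  with () ← trans (≡.sym bent) (isBend-sameLine false p r (trans (≡.sym l) (≡.sym l′)))

lower upper : Direction → ℤ → ℤ → ℤ
lower true u v = u
lower false u v = v
upper true u v = v
upper false u v = u

Run : Orientation → Direction → Point → Point → Set
Run o s a b = across o b ≡ across o a × lower s (along o a) (along o b) < upper s (along o a) (along o b)

OnRun : Orientation → Direction → Point → Point → GEdge → Set
OnRun o s a b e = orientation e ≡ o × lineOf e ≡ across o a ×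
  (lower s (along o a) (along o b) ≤ startOf e × startOf e < upper s (along o a) (along o b))

step-run : ∀ o s a q → Step o s a q → Run o s a q × (∀ e → (e ≡ stepEdge o s a q) ⇔ OnRun o s a q e)
step-run o true a q (l , q≡a+1) = (l , a<q) , λ e → mk⇔ (onRun e) (≡step e)
  where
  a<q : along o a < along o q
  a<q = subst (along o a <_) (≡.sym q≡a+1) (x<x+1 _)
  onRun : ∀ e → e ≡ stepEdge o true a q → OnRun o true a q e
  onRun e refl = orientation-edge o _ _ , lineOf-edge o _ _ ,
    ℤP.≤-reflexive (≡.sym (startOf-edge o _ _)) , subst (_< along o q) (≡.sym (startOf-edge o _ _)) a<q
  ≡step : ∀ e → OnRun o true a q e → e ≡ stepEdge o true a q
  ≡step e (oe , le , lo≤ , <hi) = ≡edge oe le (ℤP.≤-antisym (<+1⇒≤ (subst (startOf e <_) q≡a+1 <hi)) lo≤)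
step-run o false a q (l , a≡q+1) = (l , q<a) , λ e → mk⇔ (onRun e) (≡step e)
  where
  q<a : along o q < along o a
  q<a = subst (along o q <_) (≡.sym a≡q+1) (x<x+1 _)
  onRun : ∀ e → e ≡ stepEdge o false a q → OnRun o false a q e
  onRun e refl = orientation-edge o _ _ , trans (lineOf-edge o _ _) l ,
    ℤP.≤-reflexive (≡.sym (startOf-edge o _ _)) , subst (_< along o a) (≡.sym (startOf-edge o _ _)) q<a
  ≡step : ∀ e → OnRun o false a q e → e ≡ stepEdge o false a q
  ≡step e (oe , le , lo≤ , <hi) =
    ≡edge oe (trans le (≡.sym l)) (ℤP.≤-antisym (<+1⇒≤ (subst (startOf e <_) a≡q+1 <hi)) lo≤)

run-cons : ∀ o s p a b → Step o s p a → Run o s a b →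
  Run o s p b × (∀ e → (e ≡ stepEdge o s p a ⊎ OnRun o s a b e) ⇔ OnRun o s p b e)
run-cons o true p a b (l , a≡p+1) (l′ , a<b) = (trans l′ l , p<b) , λ e → mk⇔ (onRun e) (split e)
  where
  p<a : along o p < along o a
  p<a = subst (along o p <_) (≡.sym a≡p+1) (x<x+1 _)
  p<b : along o p < along o b
  p<b = ℤP.<-trans p<a a<b
  onRun : ∀ e → e ≡ stepEdge o true p a ⊎ OnRun o true a b e → OnRun o true p b e
  onRun e (inj₁ refl) = orientation-edge o _ _ , lineOf-edge o _ _ ,
    ℤP.≤-reflexive (≡.sym (startOf-edge o _ _)) , subst (_< along o b) (≡.sym (startOf-edge o _ _)) p<b
  onRun e (inj₂ (oe , le , lo≤ , <hi)) = oe , trans le l , ℤP.<⇒≤ (ℤP.<-≤-trans p<a lo≤) , <hi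
  split : ∀ e → OnRun o true p b e → e ≡ stepEdge o true p a ⊎ OnRun o true a b e
  split e (oe , le , lo≤ , <hi) with ≤⇒≡⊎+1≤ lo≤
  ... | inj₁ eq = inj₁ (≡edge oe le eq)
  ... | inj₂ lo< = inj₂ (oe , trans le (≡.sym l) , subst (_≤ startOf e) (≡.sym a≡p+1) lo< , <hi)
run-cons o false p a b (l , p≡a+1) (l′ , b<a) = (trans l′ l , b<p) , λ e → mk⇔ (onRun e) (split e)
  where
  a<p : along o a < along o p
  a<p = subst (along o a <_) (≡.sym p≡a+1) (x<x+1 _)
  b<p : along o b < along o p
  b<p = ℤP.<-trans b<a a<p
  onRun : ∀ e → e ≡ stepEdge o false p a ⊎ OnRun o false a b e → OnRun o false p b e
  onRun e (inj₁ refl) = orientation-edge o _ _ , trans (lineOf-edge o _ _) l ,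
    subst (along o b ≤_) (≡.sym (startOf-edge o _ _)) (ℤP.<⇒≤ b<a) ,
    subst (_< along o p) (≡.sym (startOf-edge o _ _)) a<p
  onRun e (inj₂ (oe , le , lo≤ , <hi)) = oe , trans le l , lo≤ , ℤP.<-trans <hi a<p
  split : ∀ e → OnRun o false p b e → e ≡ stepEdge o false p a ⊎ OnRun o false a b e
  split e (oe , le , lo≤ , <hi) with ≤⇒≡⊎< (<+1⇒≤ (subst (startOf e <_) p≡a+1 <hi))
  ... | inj₁ eq = inj₁ (≡edge oe (trans le (≡.sym l)) eq)
  ... | inj₂ <a = inj₂ (oe , trans le (≡.sym l) , lo≤ , <a)

-- Paths with at most one bend

Edges : List Point → GEdge → Set
Edges L e = Any (λ pq → Joins e (proj₁ pq) (proj₂ pq)) (pairs L)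

Connected : List Point → Set
Connected L = All (λ pq → Σ GEdge λ e → Joins e (proj₁ pq) (proj₂ pq)) (pairs L)

Edges-∷ : ∀ a q xs e → Edges (a ∷ q ∷ xs) e ⇔ (Joins e a q ⊎ Edges (q ∷ xs) e)
Edges-∷ a q xs e = mk⇔ (λ { (here j) → inj₁ j ; (there x) → inj₂ x }) [ here , there ]

record StraightRun (a q : Point) (xs : List Point) : Set where
  field
    o : Orientation
    s : Direction
    end : Point
    first : Step o s a q
    run : Run o s a end
    edges : ∀ e → Edges (a ∷ q ∷ xs) e ⇔ OnRun o s a end e

data AtMostOneBend (a q : Point) (xs : List Point) : Set where
  straight : StraightRun a q xs → AtMostOneBend a q xs
  bent : (o : Orientation) (s s′ : Direction) (b c : Point) → Step o s a q → Run o s a b → Run (not o) s′ b c →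
    (∀ e → Edges (a ∷ q ∷ xs) e ⇔ (OnRun o s a b e ⊎ OnRun (not o) s′ b c e)) → AtMostOneBend a q xs

straight-∷ : ∀ a q r ys → (Σ GEdge λ e → Joins e a q) → a ≢ r → isBend a r ≡ false →
  StraightRun q r ys → StraightRun a q (r ∷ ys)
straight-∷ a q r ys (e , j) a≢r unbent S with Joins⇒Step {e} j
... | s , st , _
  with unbent⇒straight (orientation e) s (StraightRun.o S) (StraightRun.s S) st (StraightRun.first S) a≢r unbent
... | refl , refl with run-cons (orientation e) s a q (StraightRun.end S) st (StraightRun.run S)
... | run , edges = record
  { o = orientation e ; s = s ; end = StraightRun.end S ; first = st ; run = run
  ; edges = λ e′ → ⇔-trans (Edges-∷ a q (r ∷ ys) e′)
      (⇔-trans (Joins⇔≡stepEdge (orientation e) s a q st e′ ⊎-⇔ StraightRun.edges S e′) (edges e′)) }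

head≢third : ∀ {a q r : Point} {ys} → Unique (a ∷ q ∷ r ∷ ys) → a ≢ r
head≢third ((_ ∷ a≢r ∷ _) ∷ _) = a≢r

unique-tail : ∀ {a : Point} {ys} → Unique (a ∷ ys) → Unique ys
unique-tail (_ ∷ u) = u

bends≡0⇒straight : ∀ a q xs → Connected (a ∷ q ∷ xs) → Unique (a ∷ q ∷ xs) →
  bends (a ∷ q ∷ xs) ≡ 0 → StraightRun a q xs
bends≡0⇒straight a q [] ((e , j) ∷ []) _ _ with Joins⇒Step {e} j
... | s , st , _ with step-run (orientation e) s a q st
... | run , edges = record
  { o = orientation e ; s = s ; end = q ; first = st ; run = run
  ; edges = λ e′ → ⇔-trans (Edges-∷ a q [] e′) (⇔-trans (mk⇔ [ id , (λ ()) ] inj₁)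
      (⇔-trans (Joins⇔≡stepEdge (orientation e) s a q st e′) (edges e′))) }
bends≡0⇒straight a q (r ∷ ys) (j ∷ js) u b≡0 with isBend a r in bend≡
... | true with () ← b≡0
... | false = straight-∷ a q r ys j (head≢third u) bend≡ (bends≡0⇒straight q r ys js (unique-tail u) b≡0)

bends≤1⇒atMostOneBend : ∀ a q xs → Connected (a ∷ q ∷ xs) → Unique (a ∷ q ∷ xs) →
  bends (a ∷ q ∷ xs) ℕ.≤ 1 → AtMostOneBend a q xs
bends≤1⇒atMostOneBend a q [] js u _ = straight (bends≡0⇒straight a q [] js u refl)
bends≤1⇒atMostOneBend a q (r ∷ ys) ((e , j) ∷ js) u b≤1 with isBend a r in bend≡
... | true = turn (bends≡0⇒straight q r ys js (unique-tail u) (ℕP.n≤0⇒n≡0 (ℕ.s≤s⁻¹ b≤1)))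
  where
  turn : StraightRun q r ys → AtMostOneBend a q (r ∷ ys)
  turn S with Joins⇒Step {e} j
  ... | s , st , _ with bent⇒turn (orientation e) s (StraightRun.o S) (StraightRun.s S) st (StraightRun.first S) bend≡
  ... | refl with step-run (orientation e) s a q st
  ... | run , edges = bent (orientation e) s (StraightRun.s S) q (StraightRun.end S) st run (StraightRun.run S)
        λ e′ → ⇔-trans (Edges-∷ a q (r ∷ ys) e′)
          (⇔-trans (Joins⇔≡stepEdge (orientation e) s a q st e′) (edges e′) ⊎-⇔ StraightRun.edges S e′)
... | false with bends≤1⇒atMostOneBend q r ys js (unique-tail u) b≤1
...   | straight S = straight (straight-∷ a q r ys (e , j) (head≢third u) bend≡ S)
...   | bent o s s′ b c st run run′ edges with Joins⇒Step {e} j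
...     | s₀ , st₀ , _ with unbent⇒straight (orientation e) s₀ o s st₀ st (head≢third u) bend≡
...       | refl , refl with run-cons o s a q b st₀ run
...         | run₀ , edges₀ = bent o s s′ b c st₀ run₀ run′
          λ e′ → ⇔-trans (Edges-∷ a q (r ∷ ys) e′)
            (⇔-trans (Joins⇔≡stepEdge o s a q st₀ e′ ⊎-⇔ edges e′)
            (⇔-trans (mk⇔ assocˡ assocʳ) (edges₀ e′ ⊎-⇔ ⇔-refl)))

-- Shapes

-- For each orientation o the edges edge o (line o) c with lo o ≤ c < hi o; when both parts
-- are nonempty they meet at the bend, so the line of each part is an end of the other.
record Shape : Set where
  field
    line lo hi : Orientation → ℤ
    corner : ∀ o → lo o < hi o → lo (not o) < hi (not o) → line (not o) ≡ lo o ⊎ line (not o) ≡ hi o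
open Shape public

On : Shape → Orientation → ℤ → ℤ → Set
On S o l c = l ≡ line S o × lo S o ≤ c × c < hi S o

_∈S_ : GEdge → Shape → Set
e ∈S S = On S (orientation e) (lineOf e) (startOf e)

edge∈S≡On : ∀ S o l c → (edge o l c ∈S S) ≡ On S o l c
edge∈S≡On S true l c = refl
edge∈S≡On S false l c = refl

byOrientation : Orientation → ℤ → ℤ → Orientation → ℤ
byOrientation true x y true = x
byOrientation true x y false = y
byOrientation false x y true = y
byOrientation false x y false = x

end∈bounds : ∀ s u v → v ≡ lower s u v ⊎ v ≡ upper s u v
end∈bounds true u v = inj₂ refl
end∈bounds false u v = inj₁ refl

start∈bounds : ∀ s {x} u v → x ≡ u → x ≡ lower s u v ⊎ x ≡ upper s u v
start∈bounds true u v refl = inj₁ refl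
start∈bounds false u v refl = inj₂ refl

0≮0 : ¬ (0ℤ < 0ℤ)
0≮0 = ℤP.<-irrefl refl

straightShape : Orientation → Direction → Point → Point → Shape
straightShape true s a b = record
  { line = byOrientation true (across true a) 0ℤ
  ; lo = byOrientation true (lower s (along true a) (along true b)) 0ℤ
  ; hi = byOrientation true (upper s (along true a) (along true b)) 0ℤ
  ; corner = λ { true _ 0<0 → ⊥-elim (0≮0 0<0) ; false 0<0 _ → ⊥-elim (0≮0 0<0) } }
straightShape false s a b = record
  { line = byOrientation false (across false a) 0ℤ
  ; lo = byOrientation false (lower s (along false a) (along false b)) 0ℤ
  ; hi = byOrientation false (upper s (along false a) (along false b)) 0ℤ
  ; corner = λ { true 0<0 _ → ⊥-elim (0≮0 0<0) ; false _ 0<0 → ⊥-elim (0≮0 0<0) } }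

∈straightShape⇔ : ∀ o s a b e → e ∈S straightShape o s a b ⇔ OnRun o s a b e
∈straightShape⇔ true s a b (hor x y) = mk⇔ (λ on → refl , on) proj₂
∈straightShape⇔ true s a b (ver x y) = mk⇔ (λ (_ , 0≤ , <0) → ⊥-elim (0≮0 (ℤP.≤-<-trans 0≤ <0))) (λ ())
∈straightShape⇔ false s a b (hor x y) = mk⇔ (λ (_ , 0≤ , <0) → ⊥-elim (0≮0 (ℤP.≤-<-trans 0≤ <0))) (λ ())
∈straightShape⇔ false s a b (ver x y) = mk⇔ (λ on → refl , on) proj₂

bentShape : (o : Orientation) (s s′ : Direction) (a b c : Point) → across o b ≡ across o a → Shape
bentShape true s s′ a b c l = record
  { line = byOrientation true (across true a) (across false b)
  ; lo = byOrientation true (lower s (along true a) (along true b)) (lower s′ (along false b) (along false c))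
  ; hi = byOrientation true (upper s (along true a) (along true b)) (upper s′ (along false b) (along false c))
  ; corner = λ { true _ _ → end∈bounds s (along true a) (along true b)
               ; false _ _ → start∈bounds s′ (along false b) (along false c) (≡.sym l) } }
bentShape false s s′ a b c l = record
  { line = byOrientation false (across false a) (across true b)
  ; lo = byOrientation false (lower s (along false a) (along false b)) (lower s′ (along true b) (along true c))
  ; hi = byOrientation false (upper s (along false a) (along false b)) (upper s′ (along true b) (along true c))
  ; corner = λ { false _ _ → end∈bounds s (along false a) (along false b)
               ; true _ _ → start∈bounds s′ (along true b) (along true c) (≡.sym l) } }

∈bentShape⇔ : ∀ o s s′ a b c l e →
  e ∈S bentShape o s s′ a b c l ⇔ (OnRun o s a b e ⊎ OnRun (not o) s′ b c e)
∈bentShape⇔ true s s′ a b c l (hor x y) = mk⇔ (λ on → inj₁ (refl , on)) [ proj₂ , (λ ()) ∘ proj₁ ]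
∈bentShape⇔ true s s′ a b c l (ver x y) = mk⇔ (λ on → inj₂ (refl , on)) [ (λ ()) ∘ proj₁ , proj₂ ]
∈bentShape⇔ false s s′ a b c l (ver x y) = mk⇔ (λ on → inj₁ (refl , on)) [ proj₂ , (λ ()) ∘ proj₁ ]
∈bentShape⇔ false s s′ a b c l (hor x y) = mk⇔ (λ on → inj₂ (refl , on)) [ (λ ()) ∘ proj₁ , proj₂ ]

b1-shape : (P : GridPath) → bends (pts P) ℕ.≤ 1 → Σ Shape λ S → ∀ e → e ∈E P ⇔ e ∈S S
b1-shape P = shape (pts P) (nontrivial P) (steps P) (simple P)
  where
  shape : (L : List Point) → 2 ℕ.≤ length L → Connected L → Unique L → bends L ℕ.≤ 1 →
    Σ Shape λ S → ∀ e → Edges L e ⇔ e ∈S S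
  shape (a ∷ []) (s≤s ()) _ _ _
  shape (a ∷ q ∷ xs) _ js u b≤1 with bends≤1⇒atMostOneBend a q xs js u b≤1
  ... | straight S = straightShape (StraightRun.o S) (StraightRun.s S) a (StraightRun.end S)
    , λ e → ⇔-trans (StraightRun.edges S e)
                (⇔-sym (∈straightShape⇔ (StraightRun.o S) (StraightRun.s S) a (StraightRun.end S) e))
  ... | bent o s s′ b c _ run _ edges = bentShape o s s′ a b c (proj₁ run)
    , λ e → ⇔-trans (edges e) (⇔-sym (∈bentShape⇔ o s s′ a b c (proj₁ run) e))

path-has-edge : (P : GridPath) → ∃ λ e → e ∈E P
path-has-edge P = edgeOf (pts P) (nontrivial P) (steps P)
  where
  edgeOf : (L : List Point) → 2 ℕ.≤ length L → Connected L → ∃ (Edges L)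
  edgeOf (a ∷ []) (s≤s ()) _
  edgeOf (a ∷ q ∷ xs) _ ((e , j) ∷ _) = e , here j

NonemptyOn : Shape → Orientation → ℤ → Set
NonemptyOn S o l = line S o ≡ l × lo S o < hi S o

On⇒NonemptyOn : ∀ S {o l c} → On S o l c → NonemptyOn S o l
On⇒NonemptyOn S (l≡ , lo≤c , c<hi) = ≡.sym l≡ , ℤP.≤-<-trans lo≤c c<hi

On? : ∀ S o l c → Dec (On S o l c)
On? S o l c = (l ℤP.≟ line S o) ×-dec ((lo S o ℤP.≤? c) ×-dec (c ℤP.<? hi S o))

NonemptyOn? : ∀ S o l → Dec (NonemptyOn S o l)
NonemptyOn? S o l = (line S o ℤP.≟ l) ×-dec (lo S o ℤP.<? hi S o)

shared-line : ∀ S T {o l c L} → On S o l c → On T o l c → line T o ≡ L → NonemptyOn S o L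
shared-line S T onS (l≡T , _) T≡L = trans (≡.sym (proj₁ onS)) (trans l≡T T≡L) , proj₂ (On⇒NonemptyOn S onS)

corner-≢ : ∀ S {o p} → p ≢ o → lo S o < hi S o → lo S p < hi S p → line S p ≡ lo S o ⊎ line S p ≡ hi S o
corner-≢ S {o} p≢o with BoolP.¬-not p≢o
... | refl = corner S o

corner-bounds : ∀ S {o p} → p ≢ o → lo S o < hi S o → lo S p < hi S p → lo S o ≤ line S p × line S p ≤ hi S o
corner-bounds S p≢o S-o S-p with corner-≢ S p≢o S-o S-p
... | inj₁ line≡lo = ℤP.≤-reflexive (≡.sym line≡lo) , subst (_≤ _) (≡.sym line≡lo) (ℤP.<⇒≤ S-o)
... | inj₂ line≡hi = subst (_ ≤_) (≡.sym line≡hi) (ℤP.<⇒≤ S-o) , ℤP.≤-reflexive line≡hi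

endpoint : Direction → Shape → Orientation → ℤ
endpoint true S p = lo S p
endpoint false S p = hi S p

-- start of the edge of the arm that is incident to its endpoint l
edgeAt : Direction → ℤ → ℤ
edgeAt true l = l
edgeAt false l = pred l

On-edgeAt : ∀ d S p {m l} → NonemptyOn S p m → endpoint d S p ≡ l → On S p m (edgeAt d l)
On-edgeAt true S p (refl , lo<hi) refl = refl , ℤP.≤-refl , lo<hi
On-edgeAt false S p (refl , lo<hi) refl = refl , ℤP.i<j⇒i≤pred[j] lo<hi , ℤP.i≤pred[j]⇒i<j ℤP.≤-refl

-- The arm of S on line m shares an edge with that of T, so its end on line l is on the same
-- side d as T's; otherwise the two arms would lie on opposite sides of l.
sharedArm⇒On-edgeAt : ∀ d (S T : Shape) {o p m l l′ c} → p ≢ o →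
  line S o ≡ l → lo S o < hi S o → line T p ≡ m → endpoint d T p ≡ l →
  On S p l′ c → On T p l′ c → On S p m (edgeAt d l)
sharedArm⇒On-edgeAt d S T {o} {p} p≢o refl S-o T-p T-end onS onT =
  arm d T-end (corner-≢ S (p≢o ∘ ≡.sym) (proj₂ (On⇒NonemptyOn S onS)) S-o)
  where
  S-p : NonemptyOn S p _
  S-p = shared-line S T onS onT T-p
  arm : ∀ d → endpoint d T p ≡ line S o → line S o ≡ lo S p ⊎ line S o ≡ hi S p →
    On S p _ (edgeAt d (line S o))
  arm true _ (inj₁ l≡lo) = On-edgeAt true S p S-p (≡.sym l≡lo)
  arm false _ (inj₂ l≡hi) = On-edgeAt false S p S-p (≡.sym l≡hi)
  arm true loT≡l (inj₂ l≡hi) = ⊥-elim (ℤP.<-irrefl refl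
    (ℤP.<-≤-trans (proj₂ (proj₂ onS)) (subst (_≤ _) (trans loT≡l l≡hi) (proj₁ (proj₂ onT)))))
  arm false hiT≡l (inj₁ l≡lo) = ⊥-elim (ℤP.<-irrefl refl
    (ℤP.<-≤-trans (proj₂ (proj₂ onT)) (subst (_≤ _) (≡.sym (trans hiT≡l l≡lo)) (proj₁ (proj₂ onS)))))

∈S-≡ : ∀ S {e o} → orientation e ≡ o → e ∈S S → On S o (lineOf e) (startOf e)
∈S-≡ S {e} = subst (λ o′ → On S o′ (lineOf e) (startOf e))

∈S-≢ : ∀ S {e o} → orientation e ≢ o → e ∈S S → On S (not o) (lineOf e) (startOf e)
∈S-≢ S e≢o = ∈S-≡ S (BoolP.¬-not e≢o)

point : Orientation → ℤ → ℤ → Point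
point true l c = c , l
point false l c = l , c

point-swap : ∀ {p o} → p ≢ o → ∀ m l → point p m l ≡ point o l m
point-swap {true} {false} _ m l = refl
point-swap {false} {true} _ m l = refl
point-swap {true} {true} p≢o = ⊥-elim (p≢o refl)
point-swap {false} {false} p≢o = ⊥-elim (p≢o refl)

edgeAt-incident : ∀ d o l c → Incident (edge o l (edgeAt d c)) (point o l c)
edgeAt-incident true true l c = inj₁ refl
edgeAt-incident true false l c = inj₁ refl
edgeAt-incident false true l c = inj₂ (cong (_, l) (≡.sym (pred[x]+1≡x c)))
edgeAt-incident false false l c = inj₂ (cong (l ,_) (≡.sym (pred[x]+1≡x c)))

edge-≢-orientation : ∀ {o o′ l l′ c c′} → o ≢ o′ → edge o l c ≢ edge o′ l′ c′
edge-≢-orientation {o} {o′} {l} {l′} {c} {c′} o≢o′ eq =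
  o≢o′ (trans (≡.sym (orientation-edge o l c)) (trans (cong orientation eq) (orientation-edge o′ l′ c′)))

edge-≢-start : ∀ {o o′ l l′ c c′} → c ≢ c′ → edge o l c ≢ edge o′ l′ c′
edge-≢-start {o} {o′} {l} {l′} {c} {c′} c≢c′ eq =
  c≢c′ (trans (≡.sym (startOf-edge o l c)) (trans (cong startOf eq) (startOf-edge o′ l′ c′)))

-- Finite sets and maximal cliques

¬¬-∀Fin : ∀ {k} (P : Fin k → Set) → (∀ i → ¬ ¬ P i) → ¬ ¬ (∀ i → P i)
¬¬-∀Fin {ℕ.zero} P _ ¬∀ = ¬∀ (λ ())
¬¬-∀Fin {ℕ.suc k} P ¬¬P ¬∀ = ¬¬P Fin.zero λ P₀ →
  ¬¬-∀Fin (P ∘ Fin.suc) (¬¬P ∘ Fin.suc) λ P₊ → ¬∀ λ { Fin.zero → P₀ ; (Fin.suc i) → P₊ i }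

all-or-counterexample : ∀ {k} (K : Subset k) {P : Fin k → Set} → (∀ v → Dec (P v)) →
  (∀ v → v ∈ K → P v) ⊎ ∃ λ v → v ∈ K × ¬ P v
all-or-counterexample K P? with FinP.any? (λ v → (v ∈? K) ×-dec ¬? (P? v))
... | yes (v , v∈K , ¬Pv) = inj₂ (v , v∈K , ¬Pv)
... | no ∄ = inj₁ λ v v∈K → decidable-stable (P? v) (λ ¬Pv → ∄ (v , v∈K , ¬Pv))

argmin-on : ∀ {k} (K : Subset k) (f : Fin k → ℤ) {v} → v ∈ K →
  Σ (Fin k) λ a → a ∈ K × ∀ w → w ∈ K → f a ≤ f w
argmin-on {k} K f {v} v∈K =
  argmin f v members , argmin-all f v∈K (all-filter (_∈? K) (allFin k)) ,
  λ w w∈K → All.lookup (f[argmin]≤f[xs] {f = f} v members) (∈-filter⁺ (_∈? K) (∈-allFin w) w∈K)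
  where
  members : List (Fin k)
  members = filter (_∈? K) (allFin k)

clique-∪⁅⁆ : ∀ G {K} w → IsClique G K → (∀ u → u ∈ K → Adj G w u) → IsClique G (K ∪ ⁅ w ⁆)
clique-∪⁅⁆ G {K} w clique w~K u v u∈ v∈ u≢v with x∈p∪q⁻ K ⁅ w ⁆ u∈ | x∈p∪q⁻ K ⁅ w ⁆ v∈
... | inj₁ u∈K | inj₁ v∈K = clique u v u∈K v∈K u≢v
... | inj₁ u∈K | inj₂ v∈w rewrite x∈⁅y⁆⇒x≡y w v∈w = sym G (w~K u u∈K)
... | inj₂ u∈w | inj₁ v∈K rewrite x∈⁅y⁆⇒x≡y w u∈w = w~K v v∈K
... | inj₂ u∈w | inj₂ v∈w = ⊥-elim (u≢v (trans (x∈⁅y⁆⇒x≡y w u∈w) (≡.sym (x∈⁅y⁆⇒x≡y w v∈w))))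

-- If w were adjacent to all of K it would extend K; a non-neighbour u in K closes a diamond u x y w.
-- Adjacency need not be decidable, hence the double negation.
≤1-neighbour-in-maximalClique : ∀ G {K} → DiamondFree G → IsMaximalClique G K →
  ∀ {w x y} → w ∉ K → x ∈ K → y ∈ K → x ≢ y → Adj G w x → Adj G w y → ⊥
≤1-neighbour-in-maximalClique G {K} diamondFree (clique , maximal) {w} {x} {y} w∉K x∈K y∈K x≢y w~x w~y =
  ¬¬-∀Fin (λ u → u ∈ K → Adj G w u) w~u (w∉K ∘ extends)
  where
  extends : (∀ u → u ∈ K → Adj G w u) → w ∈ K
  extends w~K =
    maximal (K ∪ ⁅ w ⁆) (clique-∪⁅⁆ G w clique w~K) (p⊆p∪q ⁅ w ⁆) (x∈p∪q⁺ (inj₂ (x∈⁅x⁆ w)))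
  ≢w : ∀ {v} → v ∈ K → v ≢ w
  ≢w v∈K refl = w∉K v∈K
  w~u : ∀ u → ¬ ¬ (u ∈ K → Adj G w u)
  w~u u ¬w~u with u ∈? K
  ... | no u∉K = ¬w~u (⊥-elim ∘ u∉K)
  ... | yes u∈K = diamondFree u x y w u≢x u≢y (≢w u∈K) x≢y (≢w x∈K) (≢w y∈K)
      (clique u x u∈K x∈K u≢x , clique u y u∈K y∈K u≢y , clique x y x∈K y∈K x≢y ,
       sym G w~x , sym G w~y , ¬w~u ∘ const ∘ sym G)
    where
    u≢x : u ≢ x
    u≢x refl = ¬w~u (const w~x)
    u≢y : u ≢ y
    u≢y refl = ¬w~u (const w~y)

-- Maximal claw-cliques

module MaximalClawClique (G : Graph) (diamondFree : DiamondFree G) (R : EPGRep G) (b1 : IsB1 R)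
  (K : Subset (n G)) (maximal : IsMaximalClique G K) (clawClique : IsClawClique R K) where

  shape : Fin (n G) → Shape
  shape v = proj₁ (b1-shape (path R v) (b1 v))

  ∈E⇔∈S : ∀ v e → e ∈E path R v ⇔ e ∈S shape v
  ∈E⇔∈S v = proj₂ (b1-shape (path R v) (b1 v))

  On⇒∈E : ∀ {v o l c} → On (shape v) o l c → edge o l c ∈E path R v
  On⇒∈E {v} {o} {l} {c} = from (∈E⇔∈S v (edge o l c)) ∘ subst id (≡.sym (edge∈S≡On (shape v) o l c))

  ∈E⇒On : ∀ {v o l c} → edge o l c ∈E path R v → On (shape v) o l c
  ∈E⇒On {v} {o} {l} {c} = subst id (edge∈S≡On (shape v) o l c) ∘ to (∈E⇔∈S v (edge o l c))

  share : ∀ {u v} → u ∈ K → v ∈ K → u ≢ v → ∃ λ e → e ∈S shape u × e ∈S shape v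
  share {u} {v} u∈K v∈K u≢v with proj₁ (adj-iff R u v u≢v) (proj₁ maximal u v u∈K v∈K u≢v)
  ... | e , e∈u , e∈v = e , to (∈E⇔∈S u e) e∈u , to (∈E⇔∈S v e) e∈v

  adjacent : ∀ {u v o l c} → u ≢ v → On (shape u) o l c → On (shape v) o l c → Adj G u v
  adjacent {u} {v} {o} {l} {c} u≢v onU onV = proj₂ (adj-iff R u v u≢v) (edge o l c , On⇒∈E onU , On⇒∈E onV)

  missing : ∀ o l c → ∃ λ v → v ∈ K × ¬ On (shape v) o l c
  missing o l c with all-or-counterexample K (λ v → On? (shape v) o l c)
  ... | inj₁ all = ⊥-elim (proj₂ clawClique (edge o l c , λ v v∈K → On⇒∈E (all v v∈K)))
  ... | inj₂ v = v

  member : ∃ λ v → v ∈ K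
  member with missing true 0ℤ 0ℤ
  ... | v , v∈K , _ = v , v∈K

  CommonLine : Orientation → ℤ → Set
  CommonLine o ℓ = ∀ v → v ∈ K → NonemptyOn (shape v) o ℓ

  Escape : Shape → Orientation → Fin (n G) → Set
  Escape S o u = ¬ NonemptyOn (shape u) o (line S o) × NonemptyOn (shape u) (not o) (line S (not o))

  -- a member of K that avoids v₀'s line in o shares an edge with v₀, necessarily in not o
  common-or-escape : ∀ {v₀} → v₀ ∈ K → ∀ o → lo (shape v₀) o < hi (shape v₀) o →
    CommonLine o (line (shape v₀) o) ⊎
    (lo (shape v₀) (not o) < hi (shape v₀) (not o) × ∃ λ u → u ∈ K × Escape (shape v₀) o u)
  common-or-escape {v₀} v₀∈K o v₀-o
    with all-or-counterexample K (λ v → NonemptyOn? (shape v) o (line (shape v₀) o))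
  ... | inj₁ common = inj₁ common
  ... | inj₂ (u , u∈K , u-off) with share u∈K v₀∈K (λ { refl → u-off (refl , v₀-o) })
  ...   | e , e∈u , e∈v₀ with orientation e Bool.≟ o
  ...     | yes refl = ⊥-elim (u-off (shared-line (shape u) (shape v₀) e∈u e∈v₀ refl))
  ...     | no e≢o = inj₂ (proj₂ (On⇒NonemptyOn (shape v₀) e∈v₀′) , u , u∈K , u-off ,
                           shared-line (shape u) (shape v₀) (∈S-≢ (shape u) e≢o e∈u) e∈v₀′ refl)
    where
    e∈v₀′ : On (shape v₀) (not o) (lineOf e) (startOf e)
    e∈v₀′ = ∈S-≢ (shape v₀) e≢o e∈v₀

  -- u and w share an edge; whichever its orientation, it puts one of them on the line it avoids
  escape-avoids-common-arm : ∀ S o {u w} → u ∈ K → w ∈ K → Escape S o u →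
    ¬ NonemptyOn (shape w) (not o) (line S (not o)) → ¬ NonemptyOn (shape w) o (line S o)
  escape-avoids-common-arm S o {u} {w} u∈K w∈K (u-off , u-on) w-off w-on
    with share u∈K w∈K (λ { refl → u-off w-on })
  ... | e , e∈u , e∈w with orientation e Bool.≟ o
  ...   | yes refl = u-off (shared-line (shape u) (shape w) e∈u e∈w (proj₁ w-on))
  ...   | no e≢o =
    w-off (shared-line (shape w) (shape u) (∈S-≢ (shape w) e≢o e∈w) (∈S-≢ (shape u) e≢o e∈u) (proj₁ u-on))

  escapes-disjoint : ∀ S o {u w} → u ∈ K → w ∈ K → Escape S o u → Escape S (not o) w → ⊥
  escapes-disjoint S true u∈K w∈K u-escape (w-off , w-on) =
    escape-avoids-common-arm S true u∈K w∈K u-escape w-off w-on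
  escapes-disjoint S false u∈K w∈K u-escape (w-off , w-on) =
    escape-avoids-common-arm S false u∈K w∈K u-escape w-off w-on

  commonLine : Σ Orientation λ o → Σ ℤ (CommonLine o)
  commonLine with member
  ... | v₀ , v₀∈K with path-has-edge (path R v₀)
  ... | e , e∈v₀
    with common-or-escape v₀∈K (orientation e) (proj₂ (On⇒NonemptyOn (shape v₀) (to (∈E⇔∈S v₀ e) e∈v₀)))
  ... | inj₁ common = orientation e , _ , common
  ... | inj₂ (v₀-o′ , u , u∈K , u-escape) with common-or-escape v₀∈K (not (orientation e)) v₀-o′
  ...   | inj₁ common = not (orientation e) , _ , common
  ...   | inj₂ (_ , w , w∈K , w-escape) =
    ⊥-elim (escapes-disjoint (shape v₀) (orientation e) u∈K w∈K u-escape w-escape)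

  module FirstEnding {o ℓ} (common : CommonLine o ℓ) {a} (a∈K : a ∈ K)
    (a-min : ∀ v → v ∈ K → hi (shape a) o ≤ hi (shape v) o) where

    m : ℤ
    m = hi (shape a) o

    -- E₁, E₂, E₃ are the claw edges edge o ℓ (pred m), edge o ℓ m and edge p m (edgeAt d ℓ) of Bend

    pred[m]<m : pred m < m
    pred[m]<m = ℤP.i≤pred[j]⇒i<j ℤP.≤-refl

    a∋E₁ : On (shape a) o ℓ (pred m)
    a∋E₁ = ≡.sym (proj₁ (common a a∈K)) , ℤP.i<j⇒i≤pred[j] (proj₂ (common a a∈K)) , pred[m]<m

    m≤lo : ∀ {b} → b ∈ K → ¬ On (shape b) o ℓ (pred m) → m ≤ lo (shape b) o
    m≤lo {b} b∈K b∌E₁ with lo (shape b) o ℤP.≤? pred m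
    ... | yes lo≤ =
      ⊥-elim (b∌E₁ (≡.sym (proj₁ (common b b∈K)) , lo≤ , ℤP.<-≤-trans pred[m]<m (a-min b b∈K)))
    ... | no lo≰ = subst (_≤ lo (shape b) o) (ℤP.suc-pred m) (ℤP.i<j⇒suc[i]≤j (ℤP.≰⇒> lo≰))

    a≢b : ∀ {b} → ¬ On (shape b) o ℓ (pred m) → a ≢ b
    a≢b b∌E₁ refl = b∌E₁ a∋E₁

    module Bend {b} (b∈K : b ∈ K) (b∌E₁ : ¬ On (shape b) o ℓ (pred m))
      {e} (e∈a : e ∈S shape a) (e∈b : e ∈S shape b) where

      p : Orientation
      p = orientation e

      m≤lo-b : m ≤ lo (shape b) o
      m≤lo-b = m≤lo b∈K b∌E₁

      a-o : lo (shape a) o < m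
      a-o = proj₂ (common a a∈K)

      b-o : lo (shape b) o < hi (shape b) o
      b-o = proj₂ (common b b∈K)

      p≢o : p ≢ o
      p≢o p≡o = ℤP.<⇒≱ (proj₂ (proj₂ (∈S-≡ (shape a) p≡o e∈a)))
        (ℤP.≤-trans m≤lo-b (proj₁ (proj₂ (∈S-≡ (shape b) p≡o e∈b))))

      -- lo b ≤ line b p = line a p ≤ hi a = m ≤ lo b
      bend-at-m : line (shape a) p ≡ m × lo (shape b) o ≡ m
      bend-at-m = ℤP.≤-antisym line-a≤m (ℤP.≤-trans m≤lo-b lo-b≤line-a)
                , ℤP.≤-antisym (ℤP.≤-trans lo-b≤line-a line-a≤m) m≤lo-b
        where
        line-a≤m : line (shape a) p ≤ m
        line-a≤m = proj₂ (corner-bounds (shape a) p≢o a-o (proj₂ (On⇒NonemptyOn (shape a) e∈a)))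
        lo-b≤line-a : lo (shape b) o ≤ line (shape a) p
        lo-b≤line-a = subst (lo (shape b) o ≤_) (trans (≡.sym (proj₁ e∈b)) (proj₁ e∈a))
          (proj₁ (corner-bounds (shape b) p≢o b-o (proj₂ (On⇒NonemptyOn (shape b) e∈b))))

      a-p : NonemptyOn (shape a) p m
      a-p = proj₁ bend-at-m , proj₂ (On⇒NonemptyOn (shape a) e∈a)

      b-p : NonemptyOn (shape b) p m
      b-p = trans (trans (≡.sym (proj₁ e∈b)) (proj₁ e∈a)) (proj₁ bend-at-m) ,
            proj₂ (On⇒NonemptyOn (shape b) e∈b)

      -- both arms on line m end on line ℓ, and they overlap, so they leave ℓ in the same direction
      direction : Σ Direction λ d → endpoint d (shape a) p ≡ ℓ × endpoint d (shape b) p ≡ ℓ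
      direction = same-side (side a∈K e∈a) (side b∈K e∈b)
        where
        side : ∀ {x} → x ∈ K → e ∈S shape x → ℓ ≡ lo (shape x) p ⊎ ℓ ≡ hi (shape x) p
        side {x} x∈K e∈x = subst (λ l → l ≡ lo (shape x) p ⊎ l ≡ hi (shape x) p) (proj₁ (common x x∈K))
          (corner-≢ (shape x) (p≢o ∘ ≡.sym) (proj₂ (On⇒NonemptyOn (shape x) e∈x)) (proj₂ (common x x∈K)))
        same-side : ℓ ≡ lo (shape a) p ⊎ ℓ ≡ hi (shape a) p → ℓ ≡ lo (shape b) p ⊎ ℓ ≡ hi (shape b) p →
          Σ Direction λ d → endpoint d (shape a) p ≡ ℓ × endpoint d (shape b) p ≡ ℓ
        same-side (inj₁ ℓ≡lo-a) (inj₁ ℓ≡lo-b) = true , ≡.sym ℓ≡lo-a , ≡.sym ℓ≡lo-b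
        same-side (inj₂ ℓ≡hi-a) (inj₂ ℓ≡hi-b) = false , ≡.sym ℓ≡hi-a , ≡.sym ℓ≡hi-b
        same-side (inj₁ ℓ≡lo-a) (inj₂ ℓ≡hi-b) =
          ⊥-elim (ℤP.<⇒≱ (proj₂ (proj₂ e∈b))
            (subst (_≤ startOf e) (trans (≡.sym ℓ≡lo-a) ℓ≡hi-b) (proj₁ (proj₂ e∈a))))
        same-side (inj₂ ℓ≡hi-a) (inj₁ ℓ≡lo-b) =
          ⊥-elim (ℤP.<⇒≱ (proj₂ (proj₂ e∈a))
            (subst (_≤ startOf e) (trans (≡.sym ℓ≡lo-b) ℓ≡hi-a) (proj₁ (proj₂ e∈b))))

      d : Direction
      d = proj₁ direction

      Has₁ Has₂ Has₃ : Fin (n G) → Set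
      Has₁ v = On (shape v) o ℓ (pred m)
      Has₂ v = On (shape v) o ℓ m
      Has₃ v = On (shape v) p m (edgeAt d ℓ)

      a∋E₃ : Has₃ a
      a∋E₃ = On-edgeAt d (shape a) p a-p (proj₁ (proj₂ direction))

      b∋E₃ : Has₃ b
      b∋E₃ = On-edgeAt d (shape b) p b-p (proj₂ (proj₂ direction))

      b∋E₂ : Has₂ b
      b∋E₂ = ≡.sym (proj₁ (common b b∈K)) , ℤP.≤-reflexive (proj₂ bend-at-m) ,
             subst (_< _) (proj₂ bend-at-m) b-o

      a∌E₂ : ¬ Has₂ a
      a∌E₂ (_ , _ , m<m) = ℤP.<-irrefl refl m<m

      -- a member without E₃ shares with x an edge; one on line m would force E₃, so it lies on ℓ
      meets-on-ℓ : ∀ {v x} → v ∈ K → x ∈ K → ¬ Has₃ v →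
        NonemptyOn (shape x) p m → endpoint d (shape x) p ≡ ℓ →
        Σ ℤ λ c → (lo (shape v) o ≤ c × c < hi (shape v) o) × (lo (shape x) o ≤ c × c < hi (shape x) o)
      meets-on-ℓ {v} {x} v∈K x∈K v∌E₃ x-p x-end
        with share v∈K x∈K (λ { refl → v∌E₃ (On-edgeAt d (shape x) p x-p x-end) })
      ... | e′ , e′∈v , e′∈x with orientation e′ Bool.≟ o
      ...   | yes e′≡o = startOf e′ , proj₂ (∈S-≡ (shape v) e′≡o e′∈v) , proj₂ (∈S-≡ (shape x) e′≡o e′∈x)
      ...   | no e′≢o = ⊥-elim (v∌E₃ (sharedArm⇒On-edgeAt d (shape v) (shape x) p≢o
                (proj₁ (common v v∈K)) (proj₂ (common v v∈K)) (proj₁ x-p) x-end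
                (∈S-≡ (shape v) e′≡p e′∈v) (∈S-≡ (shape x) e′≡p e′∈x)))
        where
        e′≡p : orientation e′ ≡ p
        e′≡p = trans (BoolP.¬-not e′≢o) (≡.sym (BoolP.¬-not p≢o))

      ExactlyTwo : Fin (n G) → Set
      ExactlyTwo v =
        (Has₁ v × Has₂ v × ¬ Has₃ v) ⊎ (Has₁ v × ¬ Has₂ v × Has₃ v) ⊎ (¬ Has₁ v × Has₂ v × Has₃ v)

      lacks₃⇒has₁₂ : ∀ {v} → v ∈ K → ¬ Has₃ v → Has₁ v × Has₂ v
      lacks₃⇒has₁₂ {v} v∈K v∌E₃
        with meets-on-ℓ v∈K a∈K v∌E₃ a-p (proj₁ (proj₂ direction))
           | meets-on-ℓ v∈K b∈K v∌E₃ b-p (proj₂ (proj₂ direction))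
      ... | c , (lo-v≤c , _) , (_ , c<m) | c′ , (_ , c′<hi-v) , (lo-b≤c′ , _) =
        (on-ℓ , lo-v≤pred[m] , ℤP.<-≤-trans pred[m]<m (a-min v v∈K)) ,
        (on-ℓ , ℤP.≤-trans lo-v≤pred[m] (ℤP.<⇒≤ pred[m]<m) ,
         ℤP.≤-<-trans (subst (_≤ c′) (proj₂ bend-at-m) lo-b≤c′) c′<hi-v)
        where
        on-ℓ : ℓ ≡ line (shape v) o
        on-ℓ = ≡.sym (proj₁ (common v v∈K))
        lo-v≤pred[m] : lo (shape v) o ≤ pred m
        lo-v≤pred[m] = ℤP.i<j⇒i≤pred[j] (ℤP.≤-<-trans lo-v≤c c<m)

      -- the arm of v on line m starts at an end of its arm on ℓ, which is therefore m
      has₃⇒exactlyTwo : ∀ {v} → v ∈ K → Has₃ v → ExactlyTwo v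
      has₃⇒exactlyTwo {v} v∈K v∋E₃
        with corner-≢ (shape v) p≢o (proj₂ (common v v∈K)) (proj₂ (On⇒NonemptyOn (shape v) v∋E₃))
      ... | inj₁ line≡lo = inj₂ (inj₂ (lacks₁ , has₂ , v∋E₃))
        where
        lo≡m : lo (shape v) o ≡ m
        lo≡m = trans (≡.sym line≡lo) (≡.sym (proj₁ v∋E₃))
        lacks₁ : ¬ Has₁ v
        lacks₁ (_ , lo≤pred[m] , _) = ℤP.<⇒≱ pred[m]<m (subst (_≤ pred m) lo≡m lo≤pred[m])
        has₂ : Has₂ v
        has₂ = ≡.sym (proj₁ (common v v∈K)) , ℤP.≤-reflexive lo≡m , subst (_< _) lo≡m (proj₂ (common v v∈K))
      ... | inj₂ line≡hi = inj₂ (inj₁ (has₁ , lacks₂ , v∋E₃))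
        where
        hi≡m : hi (shape v) o ≡ m
        hi≡m = trans (≡.sym line≡hi) (≡.sym (proj₁ v∋E₃))
        has₁ : Has₁ v
        has₁ = ≡.sym (proj₁ (common v v∈K)) , ℤP.i<j⇒i≤pred[j] (subst (_ <_) hi≡m (proj₂ (common v v∈K))) ,
               subst (pred m <_) (≡.sym hi≡m) pred[m]<m
        lacks₂ : ¬ Has₂ v
        lacks₂ (_ , _ , m<hi) = ℤP.<-irrefl (≡.sym hi≡m) m<hi

      exactlyTwo : ∀ {v} → v ∈ K → ExactlyTwo v
      exactlyTwo {v} v∈K with On? (shape v) p m (edgeAt d ℓ)
      ... | yes v∋E₃ = has₃⇒exactlyTwo v∈K v∋E₃
      ... | no v∌E₃ = let (has₁ , has₂) = lacks₃⇒has₁₂ v∈K v∌E₃ in inj₁ (has₁ , has₂ , v∌E₃)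

      claw : Claw
      claw = record
        { center = point o ℓ m
        ; e₁ = edge o ℓ (edgeAt false m)
        ; e₂ = edge o ℓ (edgeAt true m)
        ; e₃ = edge p m (edgeAt d ℓ)
        ; inc₁ = edgeAt-incident false o ℓ m
        ; inc₂ = edgeAt-incident true o ℓ m
        ; inc₃ = subst (Incident (edge p m (edgeAt d ℓ))) (point-swap p≢o m ℓ) (edgeAt-incident d p m ℓ)
        ; d₁₂ = edge-≢-start (ℤP.<⇒≢ pred[m]<m)
        ; d₁₃ = edge-≢-orientation (p≢o ∘ ≡.sym)
        ; d₂₃ = edge-≢-orientation (p≢o ∘ ≡.sym)
        }

      represented : RepresentedOn R K claw
      represented v v∈K with exactlyTwo v∈K
      ... | inj₁ (has₁ , has₂ , lacks₃) = inj₁ (On⇒∈E has₁ , On⇒∈E has₂ , lacks₃ ∘ ∈E⇒On)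
      ... | inj₂ (inj₁ (has₁ , lacks₂ , has₃)) = inj₂ (inj₁ (On⇒∈E has₁ , lacks₂ ∘ ∈E⇒On , On⇒∈E has₃))
      ... | inj₂ (inj₂ (lacks₁ , has₂ , has₃)) = inj₂ (inj₂ (lacks₁ ∘ ∈E⇒On , On⇒∈E has₂ , On⇒∈E has₃))

      -- every claw edge lies on two members of K, so an outside path through it would be
      -- adjacent to both
      covered : ∀ v e → e ∈C claw → e ∈E path R v → v ∈ K
      covered v e e∈C e∈v with v ∈? K | missing p m (edgeAt d ℓ)
      ... | yes v∈K | _ = v∈K
      ... | no v∉K | y , y∈K , y∌E₃ = ⊥-elim (on-two-members e∈C)
        where
        y-has₁₂ : Has₁ y × Has₂ y
        y-has₁₂ = lacks₃⇒has₁₂ y∈K y∌E₃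
        outside : ∀ {x x′ o′ l c} → x ∈ K → x′ ∈ K → x ≢ x′ →
          On (shape x) o′ l c → On (shape x′) o′ l c → edge o′ l c ∈E path R v → ⊥
        outside x∈K x′∈K x≢x′ x∋ x′∋ v∋ =
          ≤1-neighbour-in-maximalClique G diamondFree maximal v∉K x∈K x′∈K x≢x′
            (adjacent (λ { refl → v∉K x∈K }) (∈E⇒On v∋) x∋)
            (adjacent (λ { refl → v∉K x′∈K }) (∈E⇒On v∋) x′∋)
        on-two-members : e ∈C claw → ⊥
        on-two-members (inj₁ refl) =
          outside a∈K y∈K (λ a≡y → a∌E₂ (subst Has₂ (≡.sym a≡y) (proj₂ y-has₁₂))) a∋E₁ (proj₁ y-has₁₂) e∈v
        on-two-members (inj₂ (inj₁ refl)) =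
          outside b∈K y∈K (λ b≡y → b∌E₁ (subst Has₁ (≡.sym b≡y) (proj₁ y-has₁₂))) b∋E₂ (proj₂ y-has₁₂) e∈v
        on-two-members (inj₂ (inj₂ refl)) = outside a∈K b∈K (a≢b b∌E₁) a∋E₃ b∋E₃ e∈v

lemma3 : (G : Graph) → DiamondFree G → (R : EPGRep G) → IsB1 R →
    (K : Subset (n G)) → IsMaximalClique G K → IsClawClique R K →
    Σ Claw (λ C → RepresentedOn R K C × (∀ v e → e ∈C C → e ∈E path R v → v ∈ K))
lemma3 G diamondFree R b1 K maximal clawClique =
  let open MaximalClawClique G diamondFree R b1 K maximal clawClique
      (o , ℓ , common) = commonLine
      (a , a∈K , a-min) = argmin-on K (λ v → hi (shape v) o) (proj₂ member)
      open FirstEnding common a∈K a-min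
      (b , b∈K , b∌E₁) = missing o ℓ (pred m)
      (e , e∈a , e∈b) = share a∈K b∈K (a≢b b∌E₁)
      open Bend b∈K b∌E₁ e∈a e∈b
  in claw , represented , covered
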